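{- Let $n\geq 6$ and let $\Lambda_n$ be the Lucas cube, i.e. the subgraph of the hypercube $Q_n$ induced by the binary strings $b_1\dots b_n$ with $b_ib_{i+1}=0$ for $1\le i<n$ and $b_1b_n\neq1$. If $C$ is a perfect code of $\Lambda_n$, then $0^n\in C$.
   Context: The hypercube $Q_n$ has as vertex set the binary strings of length $n$, two strings being adjacent if they differ in exactly one position. $0^n$ denotes the all-zero string of length $n$. A perfect code of a graph $G$ is a set $C$ of vertices such that every vertex of $G$ is at distance at most $1$ (in $G$) from exactly one vertex of $C$. -}

module Defs where

open import Data.Bool using (Bool; true; false; _∧_; not)
open import Data.Nat using (ℕ; zero; suc; _+_)
open import Data.Vec using (Vec; []; _∷_; head; last; replicate)
open import Data.Product using (Σ; _×_; _,_)
open import Data.Sum using (_⊎_)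
open import Relation.Binary.PropositionalEquality using (_≡_)
open import Data.Unit using (⊤)
open import Relation.Nullary using (yes; no)
open import Data.Bool using (_≟_)

Word : ℕ → Set
Word n = Vec Bool n

hamming : ∀ {n} → Word n → Word n → ℕ
hamming [] [] = 0
hamming (x ∷ xs) (y ∷ ys) with x ≟ y
... | yes _ = hamming xs ys
... | no _ = suc (hamming xs ys)

Adjacent : ∀ {n} → Word n → Word n → Set
Adjacent u v = hamming u v ≡ 1

NoConsecutiveOnes : ∀ {n} → Word n → Set
NoConsecutiveOnes [] = ⊤
NoConsecutiveOnes (x ∷ []) = ⊤
NoConsecutiveOnes (x ∷ y ∷ xs) = (x ∧ y ≡ false) × NoConsecutiveOnes (y ∷ xs)

FirstLastNotBoth : ∀ {n} → Word n → Set
FirstLastNotBoth [] = ⊤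
FirstLastNotBoth (x ∷ xs) = x ∧ last (x ∷ xs) ≡ false

IsLucas : ∀ {n} → Word n → Set
IsLucas w = NoConsecutiveOnes w × FirstLastNotBoth w

-- Closed neighbourhood in Λ_n: u is at distance ≤ 1 from v in Λ_n
-- (Λ_n is an induced subgraph, so its edges are the Q_n edges between Lucas words).
InClosedNbhd : ∀ {n} → Word n → Word n → Set
InClosedNbhd u v = (u ≡ v) ⊎ Adjacent u v

IsPerfectCodeLucas : (n : ℕ) → (Word n → Set) → Set
IsPerfectCodeLucas n C =
  (∀ c → C c → IsLucas c) ×
  (∀ v → IsLucas v →
     Σ (Word n) λ c → (C c × InClosedNbhd v c) ×
       (∀ c' → C c' → InClosedNbhd v c' → c' ≡ c))

-- Suppose 0ⁿ is not in the perfect code C. Its covering codeword is then a unit vector e_i, and every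
-- other unit vector e_k is covered by a codeword e_k + e_j; pairing k with j is an involution of the
-- positions fixing only i, so n is odd. Let a₁ = i + 1, a₂ = i + 2 (cyclically) and e_{a₁} + e_p ∈ C.
-- For b ∉ {i, a₂, p} the Lucas word e_{a₁} + e_b is covered by a codeword e_{a₁} + e_b + e_j, and pairing
-- b with j, i with a₁ (since e_{a₁} + e_i + e_{a₁} = e_i) and a₂ with p is a fixed-point-free
-- involution, so n is even.

module Submission where

open import Data.Bool using (true; false; not; _∧_)
open import Data.Bool.Properties using (not-involutive; not-¬; ¬-not; ∧-comm)
import Data.Bool as Bool
open import Data.Empty using (⊥; ⊥-elim)
open import Data.Fin using (Fin; zero; suc; fromℕ; inject₁; toℕ; punchIn; _<_; _<?_; _≟_)
open import Data.Fin.Permutation using (permutation)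
open import Data.Fin.Properties
  using (suc-injective; toℕ-inject₁; <-cmp; <-asym; <-irrefl; punchInᵢ≢i)
open import Data.Fin.Relation.Unary.Top using (view; ‵fromℕ; ‵inj₁; view-fromℕ; view-inject₁)
open import Data.Nat using (ℕ; zero; suc; pred; _+_; _*_; _≥_; s≤s)
open import Data.Nat.Properties
  using (+-0-commutativeMonoid; +-identityʳ; +-comm; 1+n≢n; m≢1+n+m; even≢odd)
open import Data.Product using (∃; ∃-syntax; _×_; _,_; proj₁; proj₂)
open import Data.Sum using (_⊎_; inj₁; inj₂)
open import Data.Unit using (tt)
open import Data.Vec using ([]; _∷_; lookup; replicate; last; _[_]%=_)
open import Data.Vec.Properties
  using (lookup∘updateAt; lookup∘updateAt′; updateAt-updateAt; updateAt-id-local;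
         updateAt-commutes; lookup-replicate)
open import Function using (_∘_; _⇔_; Equivalence; mk⇔)
open import Function.Construct.Composition using (_⇔-∘_)
open import Relation.Binary.Definitions using (Symmetric; tri<; tri≈; tri>)
open import Relation.Binary.PropositionalEquality
open import Relation.Nullary using (¬_; Dec; yes; no; contradiction)

open import Defs

open import Algebra.Properties.CommutativeMonoid.Sum +-0-commutativeMonoid
  using (sum; sum-remove; sum-permute; ∑-distrib-+; sum-cong-≗; sum-replicate-zero)

next : ∀ {m} → Fin (suc m) → Fin (suc m)
next x with view x
... | ‵fromℕ          = zero
... | ‵inj₁ {i = j} _ = suc j

next-fromℕ : ∀ m → next (fromℕ m) ≡ zero
next-fromℕ m rewrite view-fromℕ m = refl

next-inject₁ : ∀ {m} (j : Fin m) → next (inject₁ j) ≡ suc j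
next-inject₁ j rewrite view-inject₁ j = refl

next-injective : ∀ {m} {x y : Fin (suc m)} → next x ≡ next y → x ≡ y
next-injective {x = x} {y} eq with view x | view y
... | ‵fromℕ  | ‵fromℕ  = refl
... | ‵inj₁ _ | ‵inj₁ _ = cong inject₁ (suc-injective eq)

suc≢inject₁ : ∀ {m} (j : Fin m) → suc j ≢ inject₁ j
suc≢inject₁ j eq = 1+n≢n (trans (cong toℕ eq) (toℕ-inject₁ j))

suc²≢inject₁² : ∀ {m} (k : Fin m) → suc (suc k) ≢ inject₁ (inject₁ k)
suc²≢inject₁² k eq =
  m≢1+n+m (toℕ k) (sym (trans (cong toℕ eq) (trans (toℕ-inject₁ (inject₁ k)) (toℕ-inject₁ k))))

next-≢ : ∀ {m} (x : Fin (suc (suc m))) → next x ≢ x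
next-≢ x with view x
... | ‵fromℕ          = λ ()
... | ‵inj₁ {i = j} _ = suc≢inject₁ j

next-suc-≢ : ∀ {m} (j : Fin (suc (suc m))) → next (suc j) ≢ inject₁ j
next-suc-≢ j with view j
... | ‵fromℕ          = λ ()
... | ‵inj₁ {i = k} _ = suc²≢inject₁² k

next²-≢ : ∀ {m} (x : Fin (suc (suc (suc m)))) → next (next x) ≢ x
next²-≢ x with view x
... | ‵fromℕ          = λ ()
... | ‵inj₁ {i = j} _ = next-suc-≢ j

toggle : ∀ {n} → Word n → Fin n → Word n
toggle w j = w [ j ]%= not

lookup-toggle : ∀ {n} (w : Word n) j → lookup (toggle w j) j ≡ not (lookup w j)
lookup-toggle w j = lookup∘updateAt j w

lookup-toggle-≢ : ∀ {n} (w : Word n) {j x} → x ≢ j → lookup (toggle w j) x ≡ lookup w x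
lookup-toggle-≢ w {j} {x} x≢j = lookup∘updateAt′ x j x≢j w

lookup-toggle-true : ∀ {n} (w : Word n) {j x} → lookup (toggle w j) x ≡ true → lookup w x ≡ true ⊎ x ≡ j
lookup-toggle-true w {j} {x} wx with x ≟ j
... | yes x≡j = inj₂ x≡j
... | no x≢j  = inj₁ (trans (sym (lookup-toggle-≢ w x≢j)) wx)

toggle-involutive : ∀ {n} (w : Word n) j → toggle (toggle w j) j ≡ w
toggle-involutive w j = trans (updateAt-updateAt j w) (updateAt-id-local j w (not-involutive _))

toggle-comm : ∀ {n} (w : Word n) i j → toggle (toggle w i) j ≡ toggle (toggle w j) i
toggle-comm w i j with i ≟ j
... | yes refl = refl
... | no i≢j   = updateAt-commutes j i (i≢j ∘ sym) w

toggle-cancel : ∀ {n} (w : Word n) i j → toggle (toggle (toggle w i) j) i ≡ toggle w j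
toggle-cancel w i j = trans (cong (λ v → toggle v i) (toggle-comm w i j)) (toggle-involutive (toggle w j) i)

toggle-≢ : ∀ {n} (w : Word n) j → toggle w j ≢ w
toggle-≢ w j eq = not-¬ refl (sym (trans (sym (lookup-toggle w j)) (cong (λ v → lookup v j) eq)))

toggle-injective : ∀ {n} (w : Word n) {i j} → toggle w i ≡ toggle w j → i ≡ j
toggle-injective w {i} {j} eq with i ≟ j
... | yes i≡j = i≡j
... | no i≢j  = contradiction
  (trans (sym (lookup-toggle w i)) (trans (cong (λ v → lookup v i) eq) (lookup-toggle-≢ w i≢j)))
  (not-¬ refl ∘ sym)

hamming-refl : ∀ {n} (w : Word n) → hamming w w ≡ 0
hamming-refl []          = refl
hamming-refl (false ∷ w) = hamming-refl w
hamming-refl (true ∷ w)  = hamming-refl w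

hamming-toggle : ∀ {n} (w : Word n) j → hamming w (toggle w j) ≡ 1
hamming-toggle (false ∷ w) zero    = cong suc (hamming-refl w)
hamming-toggle (true ∷ w)  zero    = cong suc (hamming-refl w)
hamming-toggle (false ∷ w) (suc j) = hamming-toggle w j
hamming-toggle (true ∷ w)  (suc j) = hamming-toggle w j

hamming≡0⇒≡ : ∀ {n} (u v : Word n) → hamming u v ≡ 0 → u ≡ v
hamming≡0⇒≡ []      []      _ = refl
hamming≡0⇒≡ (x ∷ u) (y ∷ v) h with x Bool.≟ y
... | yes refl = cong (x ∷_) (hamming≡0⇒≡ u v h)

hamming≡1⇒toggle : ∀ {n} (u v : Word n) → hamming u v ≡ 1 → ∃[ j ] v ≡ toggle u j
hamming≡1⇒toggle []      []      ()
hamming≡1⇒toggle (x ∷ u) (y ∷ v) h with x Bool.≟ y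
... | yes refl = let j , v≡ = hamming≡1⇒toggle u v h in suc j , cong (x ∷_) v≡
... | no x≢y   = zero , cong₂ _∷_ (¬-not (x≢y ∘ sym)) (sym (hamming≡0⇒≡ u v (cong pred h)))

closedNbhd-toggle : ∀ {n} (v : Word n) j → InClosedNbhd v (toggle v j)
closedNbhd-toggle v j = inj₂ (hamming-toggle v j)

closedNbhd⇒toggle : ∀ {n} {v c : Word n} → InClosedNbhd v c → c ≡ v ⊎ ∃[ j ] c ≡ toggle v j
closedNbhd⇒toggle                 (inj₁ v≡c) = inj₁ (sym v≡c)
closedNbhd⇒toggle {v = v} {c = c} (inj₂ h)   = inj₂ (hamming≡1⇒toggle v c h)

NoAdjacentOnes : ∀ {m} → Word (suc m) → Set
NoAdjacentOnes w = ∀ x → lookup w x ∧ lookup w (next x) ≡ false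

last≡lookup-fromℕ : ∀ {m} (w : Word (suc m)) → last w ≡ lookup w (fromℕ m)
last≡lookup-fromℕ (b ∷ [])     = refl
last≡lookup-fromℕ (b ∷ b′ ∷ w) = last≡lookup-fromℕ (b′ ∷ w)

noConsecutiveOnes⇒ : ∀ {m} (w : Word (suc m)) → NoConsecutiveOnes w →
                     ∀ j → lookup w (inject₁ j) ∧ lookup w (suc j) ≡ false
noConsecutiveOnes⇒ (b ∷ b′ ∷ w) (b∧b′ , _)  zero    = b∧b′
noConsecutiveOnes⇒ (b ∷ b′ ∷ w) (_ , rest)  (suc j) = noConsecutiveOnes⇒ (b′ ∷ w) rest j

noConsecutiveOnes⇐ : ∀ {m} (w : Word (suc m)) →
                     (∀ j → lookup w (inject₁ j) ∧ lookup w (suc j) ≡ false) → NoConsecutiveOnes w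
noConsecutiveOnes⇐ (b ∷ [])     _ = tt
noConsecutiveOnes⇐ (b ∷ b′ ∷ w) h = h zero , noConsecutiveOnes⇐ (b′ ∷ w) (h ∘ suc)

isLucas⇒noAdjacentOnes : ∀ {m} (w : Word (suc m)) → IsLucas w → NoAdjacentOnes w
isLucas⇒noAdjacentOnes w (noConsecutive , _) x with view x
... | ‵inj₁ {i = j} _ = noConsecutiveOnes⇒ w noConsecutive j
isLucas⇒noAdjacentOnes {m} w@(b ∷ _) (_ , firstLast) x | ‵fromℕ = begin
  lookup w (fromℕ m) ∧ b ≡⟨ ∧-comm _ b ⟩
  b ∧ lookup w (fromℕ m) ≡⟨ cong (b ∧_) (sym (last≡lookup-fromℕ w)) ⟩
  b ∧ last w             ≡⟨ firstLast ⟩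
  false                  ∎
  where open ≡-Reasoning

noAdjacentOnes⇒isLucas : ∀ {m} (w : Word (suc m)) → NoAdjacentOnes w → IsLucas w
noAdjacentOnes⇒isLucas {m} w@(b ∷ _) noAdjacent = noConsecutiveOnes⇐ w consecutive , firstLast
  where
  open ≡-Reasoning
  consecutive : ∀ j → lookup w (inject₁ j) ∧ lookup w (suc j) ≡ false
  consecutive j = subst (λ y → lookup w (inject₁ j) ∧ lookup w y ≡ false) (next-inject₁ j) (noAdjacent (inject₁ j))
  firstLast : b ∧ last w ≡ false
  firstLast = begin
    b ∧ last w             ≡⟨ cong (b ∧_) (last≡lookup-fromℕ w) ⟩
    b ∧ lookup w (fromℕ m) ≡⟨ ∧-comm b _ ⟩
    lookup w (fromℕ m) ∧ b ≡⟨ subst (λ y → lookup w (fromℕ m) ∧ lookup w y ≡ false) (next-fromℕ m) (noAdjacent (fromℕ m)) ⟩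
    false                  ∎

adjacentOnes⇒¬isLucas : ∀ {m} (w : Word (suc m)) x → lookup w x ≡ true → lookup w (next x) ≡ true → ¬ IsLucas w
adjacentOnes⇒¬isLucas w x wx wnx lucas with () ← trans (sym (isLucas⇒noAdjacentOnes w lucas x)) (cong₂ _∧_ wx wnx)

onesWithin⇒isLucas : ∀ {m} (w : Word (suc (suc m))) {a b} → (∀ x → lookup w x ≡ true → x ≡ a ⊎ x ≡ b) →
                     next a ≢ b → next b ≢ a → IsLucas w
onesWithin⇒isLucas w {a} {b} onesWithin na≢b nb≢a = noAdjacentOnes⇒isLucas w noAdjacent
  where
  apart : ∀ {x} → x ≡ a ⊎ x ≡ b → next x ≡ a ⊎ next x ≡ b → ⊥
  apart (inj₁ refl) (inj₁ nx≡a) = next-≢ a nx≡a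
  apart (inj₁ refl) (inj₂ nx≡b) = na≢b nx≡b
  apart (inj₂ refl) (inj₁ nx≡a) = nb≢a nx≡a
  apart (inj₂ refl) (inj₂ nx≡b) = next-≢ b nx≡b
  noAdjacent : NoAdjacentOnes w
  noAdjacent x with lookup w x in wx | lookup w (next x) in wnx
  ... | false | _     = refl
  ... | true  | false = refl
  ... | true  | true  = ⊥-elim (apart (onesWithin x wx) (onesWithin (next x) wnx))

zeros : ∀ {n} → Word n
zeros = replicate _ false

-- These are iterated toggles, so for instance pair a a is the zero word.
single : ∀ {n} → Fin n → Word n
single a = toggle zeros a

pair : ∀ {n} → Fin n → Fin n → Word n
pair a b = toggle (single a) b

triple : ∀ {n} → Fin n → Fin n → Fin n → Word n
triple a b c = toggle (pair a b) c

zeros-isLucas : ∀ {m} → IsLucas (zeros {suc m})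
zeros-isLucas = noAdjacentOnes⇒isLucas zeros (λ x → cong (_∧ lookup zeros (next x)) (lookup-replicate x false))

ones-single : ∀ {n} {a x : Fin n} → lookup (single a) x ≡ true → x ≡ a
ones-single {x = x} h with lookup-toggle-true zeros h
... | inj₂ x≡a = x≡a
... | inj₁ h′  = contradiction (trans (sym (lookup-replicate x false)) h′) λ ()

ones-pair : ∀ {n} {a b x : Fin n} → lookup (pair a b) x ≡ true → x ≡ a ⊎ x ≡ b
ones-pair {a = a} h with lookup-toggle-true (single a) h
... | inj₁ h′  = inj₁ (ones-single h′)
... | inj₂ x≡b = inj₂ x≡b

lookup-single : ∀ {n} (a : Fin n) → lookup (single a) a ≡ true
lookup-single a = trans (lookup-toggle zeros a) (cong not (lookup-replicate a false))

lookup-single-≢ : ∀ {n} {a x : Fin n} → x ≢ a → lookup (single a) x ≡ false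
lookup-single-≢ {x = x} x≢a = trans (lookup-toggle-≢ zeros x≢a) (lookup-replicate x false)

adjacentPair-ones : ∀ {m} (x : Fin (suc (suc m))) →
                    lookup (pair x (next x)) x ≡ true × lookup (pair x (next x)) (next x) ≡ true
adjacentPair-ones x =
  trans (lookup-toggle-≢ (single x) (next-≢ x ∘ sym)) (lookup-single x) ,
  trans (lookup-toggle (single x) (next x)) (cong not (lookup-single-≢ (next-≢ x)))

single-isLucas : ∀ {m} (a : Fin (suc (suc m))) → IsLucas (single a)
single-isLucas a = onesWithin⇒isLucas _ (λ _ → inj₁ ∘ ones-single) (next-≢ a) (next-≢ a)

pair-isLucas : ∀ {m} {a b : Fin (suc (suc m))} → next a ≢ b → next b ≢ a → IsLucas (pair a b)
pair-isLucas = onesWithin⇒isLucas _ (λ _ → ones-pair)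

-- Parity of involutions

indicator : ∀ {p} {P : Set p} → Dec P → ℕ
indicator (yes _) = 1
indicator (no _)  = 0

indicator-yes : ∀ {p} {P : Set p} (d : Dec P) → P → indicator d ≡ 1
indicator-yes (yes _) _  = refl
indicator-yes (no ¬p) p  = contradiction p ¬p

indicator-no : ∀ {p} {P : Set p} (d : Dec P) → ¬ P → indicator d ≡ 0
indicator-no (yes p) ¬p = contradiction p ¬p
indicator-no (no _)  _  = refl

sum-ones : ∀ m → sum {m} (λ _ → 1) ≡ m
sum-ones zero    = refl
sum-ones (suc m) = cong suc (sum-ones m)

sum-indicator-≡ : ∀ {m} (i : Fin m) → sum (λ x → indicator (x ≟ i)) ≡ 1
sum-indicator-≡ {suc m} i = begin
  sum (λ x → indicator (x ≟ i))                                ≡⟨ sum-remove {i = i} (λ x → indicator (x ≟ i)) ⟩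
  indicator (i ≟ i) + sum (λ j → indicator (punchIn i j ≟ i))  ≡⟨ cong₂ _+_ (indicator-yes (i ≟ i) refl) others ⟩
  1                                                            ∎
  where
  open ≡-Reasoning
  others : sum (λ j → indicator (punchIn i j ≟ i)) ≡ 0
  others = trans (sum-cong-≗ (λ j → indicator-no (punchIn i j ≟ i) (punchInᵢ≢i i j))) (sum-replicate-zero m)

module Involution {m} (f : Fin m → Fin m) (involutive : ∀ x → f (f x) ≡ x) where

  ascent : Fin m → ℕ
  ascent x = indicator (x <? f x)

  fixed : Fin m → ℕ
  fixed x = indicator (f x ≟ x)

  -- A two-element orbit {x , f x} has exactly one ascent, a fixed point none.
  orbit-count : ∀ x → ascent x + ascent (f x) + fixed x ≡ 1
  orbit-count x with <-cmp x (f x)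
  ... | tri< x<fx x≢fx _ = cong₂ _+_
        (cong₂ _+_ (indicator-yes (x <? f x) x<fx)
                   (indicator-no (f x <? f (f x)) (<-asym x<fx ∘ subst (f x <_) (involutive x))))
        (indicator-no (f x ≟ x) (x≢fx ∘ sym))
  ... | tri≈ _ x≡fx _ = cong₂ _+_
        (cong₂ _+_ (indicator-no (x <? f x) (<-irrefl x≡fx))
                   (indicator-no (f x <? f (f x)) (<-irrefl (trans (sym x≡fx) (sym (involutive x))))))
        (indicator-yes (f x ≟ x) (sym x≡fx))
  ... | tri> x≮fx x≢fx fx<x = cong₂ _+_
        (cong₂ _+_ (indicator-no (x <? f x) x≮fx)
                   (indicator-yes (f x <? f (f x)) (subst (f x <_) (sym (involutive x)) fx<x)))
        (indicator-no (f x ≟ x) (x≢fx ∘ sym))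

  parity : ∃[ k ] m ≡ 2 * k + sum fixed
  parity = sum ascent , (begin
    m                                               ≡⟨ sym (sum-ones m) ⟩
    sum {m} (λ _ → 1)                               ≡⟨ sum-cong-≗ (sym ∘ orbit-count) ⟩
    sum (λ x → ascent x + ascent (f x) + fixed x)   ≡⟨ ∑-distrib-+ (λ x → ascent x + ascent (f x)) fixed ⟩
    sum (λ x → ascent x + ascent (f x)) + sum fixed ≡⟨ cong (_+ sum fixed) (∑-distrib-+ ascent (ascent ∘ f)) ⟩
    sum ascent + sum (ascent ∘ f) + sum fixed       ≡⟨ cong (λ s → sum ascent + s + sum fixed) (sym ascent-permuted) ⟩
    sum ascent + sum ascent + sum fixed             ≡⟨ cong (λ s → sum ascent + s + sum fixed) (sym (+-identityʳ _)) ⟩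
    2 * sum ascent + sum fixed                      ∎)
    where
    open ≡-Reasoning
    ascent-permuted : sum ascent ≡ sum (ascent ∘ f)
    ascent-permuted = sum-permute ascent (permutation f f involutive involutive)

  fixedPointFree⇒even : (∀ x → f x ≢ x) → ∃[ k ] m ≡ 2 * k
  fixedPointFree⇒even free = let k , m≡ = parity in k , (begin
    m                  ≡⟨ m≡ ⟩
    2 * k + sum fixed  ≡⟨ cong (2 * k +_) (trans (sum-cong-≗ (λ x → indicator-no (f x ≟ x) (free x))) (sum-replicate-zero m)) ⟩
    2 * k + 0          ≡⟨ +-identityʳ _ ⟩
    2 * k              ∎)
    where open ≡-Reasoning

  uniqueFixedPoint⇒odd : ∀ i → (∀ x → f x ≡ x ⇔ x ≡ i) → ∃[ k ] m ≡ suc (2 * k)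
  uniqueFixedPoint⇒odd i fixed⇔i = let k , m≡ = parity in k , (begin
    m                  ≡⟨ m≡ ⟩
    2 * k + sum fixed  ≡⟨ cong (2 * k +_) (trans (sum-cong-≗ fixed-at-i) (sum-indicator-≡ i)) ⟩
    2 * k + 1          ≡⟨ +-comm (2 * k) 1 ⟩
    suc (2 * k)        ∎)
    where
    open ≡-Reasoning
    fixed-at-i : ∀ x → fixed x ≡ indicator (x ≟ i)
    fixed-at-i x with f x ≟ x | x ≟ i
    ... | yes fx≡x | no x≢i  = contradiction (Equivalence.to (fixed⇔i x) fx≡x) x≢i
    ... | no fx≢x  | yes x≡i = contradiction (Equivalence.from (fixed⇔i x) x≡i) fx≢x
    ... | yes _    | yes _   = refl
    ... | no _     | no _    = refl

module Matching {m ℓ} {R : Fin m → Fin m → Set ℓ} (symmetric : Symmetric R)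
                (functional : ∀ {x y z} → R x y → R x z → y ≡ z) (partnerOf : ∀ x → ∃ (R x)) where

  partner : Fin m → Fin m
  partner = proj₁ ∘ partnerOf

  partner-involutive : ∀ x → partner (partner x) ≡ x
  partner-involutive x = functional (proj₂ (partnerOf (partner x))) (symmetric (proj₂ (partnerOf x)))

  partner-fixed⇔loop : ∀ x → partner x ≡ x ⇔ R x x
  partner-fixed⇔loop x = mk⇔ (λ px≡x → subst (R x) px≡x (proj₂ (partnerOf x)))
                             (λ Rxx → functional (proj₂ (partnerOf x)) Rxx)

  open Involution partner partner-involutive

  loopless⇒even : (∀ x → ¬ R x x) → ∃[ k ] m ≡ 2 * k
  loopless⇒even loopless = fixedPointFree⇒even (λ x → loopless x ∘ Equivalence.to (partner-fixed⇔loop x))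

  uniqueLoop⇒odd : ∀ i → (∀ x → R x x ⇔ x ≡ i) → ∃[ k ] m ≡ suc (2 * k)
  uniqueLoop⇒odd i loop⇔i = uniqueFixedPoint⇒odd i (λ x → loop⇔i x ⇔-∘ partner-fixed⇔loop x)

-- Perfect codes of Lucas cubes

module PerfectCode {m} {C : Word (suc m) → Set} (perfect : IsPerfectCodeLucas (suc m) C) where

  codeword⇒isLucas : ∀ {c} → C c → IsLucas c
  codeword⇒isLucas = proj₁ perfect _

  coveringCodeword : ∀ {v} → IsLucas v → ∃[ c ] C c × InClosedNbhd v c
  coveringCodeword {v} lucas = let c , (c∈C , v~c) , _ = proj₂ perfect v lucas in c , c∈C , v~c

  coveringCodeword-unique : ∀ {v c c′} → IsLucas v → C c → InClosedNbhd v c → C c′ → InClosedNbhd v c′ → c ≡ c′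
  coveringCodeword-unique {v} lucas c∈C v~c c′∈C v~c′ =
    let _ , _ , unique = proj₂ perfect v lucas in trans (unique _ c∈C v~c) (sym (unique _ c′∈C v~c′))

  toggledCodewords-unique : ∀ {v i j} → IsLucas v → C (toggle v i) → C (toggle v j) → i ≡ j
  toggledCodewords-unique {v} {i} {j} lucas vi∈C vj∈C =
    toggle-injective v (coveringCodeword-unique lucas vi∈C (closedNbhd-toggle v i) vj∈C (closedNbhd-toggle v j))

  codeword⇒toggle-¬codeword : ∀ {v j} → C v → ¬ C (toggle v j)
  codeword⇒toggle-¬codeword {v} {j} v∈C vj∈C = toggle-≢ v j
    (sym (coveringCodeword-unique (codeword⇒isLucas v∈C) v∈C (inj₁ refl) vj∈C (closedNbhd-toggle v j)))

  codeword-noAdjacentOnes : ∀ {w} x → C w → lookup w x ≡ true → lookup w (next x) ≡ true → ⊥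
  codeword-noAdjacentOnes {w} x w∈C wx wnx = adjacentOnes⇒¬isLucas w x wx wnx (codeword⇒isLucas w∈C)

module SingletonCodeword {m} {C : Word (suc (suc (suc m))) → Set} (perfect : IsPerfectCodeLucas (suc (suc (suc m))) C)
                         (i : Fin (suc (suc (suc m)))) (single-i∈C : C (single i)) where

  open PerfectCode perfect

  Position : Set
  Position = Fin (suc (suc (suc m)))

  zeros-¬codeword : ¬ C zeros
  zeros-¬codeword zeros∈C = codeword⇒toggle-¬codeword zeros∈C single-i∈C

  singleCodeword⇒≡ : ∀ {k} → C (single k) → k ≡ i
  singleCodeword⇒≡ k∈C = toggledCodewords-unique zeros-isLucas k∈C single-i∈C

  pair-i-¬codeword : ∀ {j} → ¬ C (pair i j)
  pair-i-¬codeword = codeword⇒toggle-¬codeword single-i∈C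

  adjacentPair-¬codeword : ∀ x → ¬ C (pair x (next x))
  adjacentPair-¬codeword x = let x-one , nx-one = adjacentPair-ones x in λ p∈C → codeword-noAdjacentOnes x p∈C x-one nx-one

  toggledAdjacentPair-codeword : ∀ x {j} → C (toggle (pair x (next x)) j) → j ≡ x ⊎ j ≡ next x
  toggledAdjacentPair-codeword x {j} p∈C with j ≟ x | j ≟ next x
  ... | yes j≡x | _        = inj₁ j≡x
  ... | no _    | yes j≡nx = inj₂ j≡nx
  ... | no j≢x  | no j≢nx  = ⊥-elim (codeword-noAdjacentOnes x p∈C
          (trans (lookup-toggle-≢ (pair x (next x)) (j≢x ∘ sym)) (proj₁ (adjacentPair-ones x)))
          (trans (lookup-toggle-≢ (pair x (next x)) (j≢nx ∘ sym)) (proj₂ (adjacentPair-ones x))))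

  pairPartner : ∀ {k} → k ≢ i → ∃[ j ] C (pair k j)
  pairPartner {k} k≢i with coveringCodeword (single-isLucas k)
  ... | c , c∈C , k~c with closedNbhd⇒toggle k~c
  ...   | inj₁ refl       = ⊥-elim (k≢i (singleCodeword⇒≡ c∈C))
  ...   | inj₂ (j , refl) = j , c∈C

  PairPartners : Position → Position → Set
  PairPartners k j = C (pair k j) ⊎ (k ≡ i × j ≡ i)

  pairPartners-sym : Symmetric PairPartners
  pairPartners-sym {k} {j} (inj₁ kj∈C)       = inj₁ (subst C (toggle-comm zeros k j) kj∈C)
  pairPartners-sym         (inj₂ (k≡i , j≡i)) = inj₂ (j≡i , k≡i)

  pairPartners-functional : ∀ {k j j′} → PairPartners k j → PairPartners k j′ → j ≡ j′
  pairPartners-functional {k} (inj₁ kj∈C)    (inj₁ kj′∈C)   = toggledCodewords-unique (single-isLucas k) kj∈C kj′∈C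
  pairPartners-functional     (inj₁ ij∈C)    (inj₂ (refl , _)) = ⊥-elim (pair-i-¬codeword ij∈C)
  pairPartners-functional     (inj₂ (refl , _)) (inj₁ ij′∈C) = ⊥-elim (pair-i-¬codeword ij′∈C)
  pairPartners-functional     (inj₂ (_ , j≡i)) (inj₂ (_ , j′≡i)) = trans j≡i (sym j′≡i)

  pairPartnerOf : ∀ k → ∃ (PairPartners k)
  pairPartnerOf k with k ≟ i
  ... | yes k≡i = i , inj₂ (k≡i , refl)
  ... | no k≢i  = let j , kj∈C = pairPartner k≢i in j , inj₁ kj∈C

  pairPartners-loop⇔ : ∀ x → PairPartners x x ⇔ x ≡ i
  pairPartners-loop⇔ x = mk⇔ loop⇒ (λ x≡i → inj₂ (x≡i , x≡i))
    where
    loop⇒ : PairPartners x x → x ≡ i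
    loop⇒ (inj₁ xx∈C)      = ⊥-elim (zeros-¬codeword (subst C (toggle-involutive zeros x) xx∈C))
    loop⇒ (inj₂ (x≡i , _)) = x≡i

  length-odd : ∃[ k ] suc (suc (suc m)) ≡ suc (2 * k)
  length-odd = Matching.uniqueLoop⇒odd pairPartners-sym pairPartners-functional pairPartnerOf i pairPartners-loop⇔

  a₁ a₂ : Position
  a₁ = next i
  a₂ = next a₁

  a₁≢i : a₁ ≢ i
  a₁≢i = next-≢ i

  p : Position
  p = proj₁ (pairPartner a₁≢i)

  a₁p∈C : C (pair a₁ p)
  a₁p∈C = proj₂ (pairPartner a₁≢i)

  p≢a₂ : p ≢ a₂
  p≢a₂ p≡a₂ = adjacentPair-¬codeword a₁ (subst (C ∘ pair a₁) p≡a₂ a₁p∈C)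

  triple-i⇒≡a₁ : ∀ {j} → C (triple a₁ i j) → j ≡ a₁
  triple-i⇒≡a₁ {j} t∈C with toggledAdjacentPair-codeword i (subst C (cong (λ w → toggle w j) (toggle-comm zeros a₁ i)) t∈C)
  ... | inj₁ refl  = ⊥-elim (a₁≢i (singleCodeword⇒≡ (subst C (toggle-involutive (single a₁) i) t∈C)))
  ... | inj₂ j≡a₁ = j≡a₁

  triple-a₂-¬codeword : ∀ {j} → ¬ C (triple a₁ a₂ j)
  triple-a₂-¬codeword t∈C with toggledAdjacentPair-codeword a₁ t∈C
  ... | inj₁ refl = next²-≢ i (singleCodeword⇒≡ (subst C (toggle-cancel zeros a₁ a₂) t∈C))
  ... | inj₂ refl = a₁≢i (singleCodeword⇒≡ (subst C (toggle-involutive (single a₁) a₂) t∈C))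

  triple-p-¬codeword : ∀ {j} → ¬ C (triple a₁ p j)
  triple-p-¬codeword = codeword⇒toggle-¬codeword a₁p∈C

  pair-a₁-isLucas : ∀ {b} → b ≢ i → b ≢ a₂ → IsLucas (pair a₁ b)
  pair-a₁-isLucas b≢i b≢a₂ = pair-isLucas (b≢a₂ ∘ sym) (b≢i ∘ next-injective)

  triple-functional : ∀ {b j j′} → C (triple a₁ b j) → C (triple a₁ b j′) → j ≡ j′
  triple-functional {b} t∈C t′∈C with b ≟ i | b ≟ a₂
  ... | yes refl | _        = trans (triple-i⇒≡a₁ t∈C) (sym (triple-i⇒≡a₁ t′∈C))
  ... | no _     | yes refl = ⊥-elim (triple-a₂-¬codeword t∈C)
  ... | no b≢i   | no b≢a₂  = toggledCodewords-unique (pair-a₁-isLucas b≢i b≢a₂) t∈C t′∈C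

  -- a₂ and p are the only positions b with no codeword triple a₁ b j: pair a₁ a₂ is not Lucas and
  -- pair a₁ p is itself a codeword. So they are paired with each other.
  TriplePartners : Position → Position → Set
  TriplePartners b j = C (triple a₁ b j) ⊎ (b ≡ a₂ × j ≡ p) ⊎ (b ≡ p × j ≡ a₂)

  triplePartners-sym : Symmetric TriplePartners
  triplePartners-sym {b} {j} (inj₁ t∈C) = inj₁ (subst C (toggle-comm (single a₁) b j) t∈C)
  triplePartners-sym (inj₂ (inj₁ (b≡a₂ , j≡p))) = inj₂ (inj₂ (j≡p , b≡a₂))
  triplePartners-sym (inj₂ (inj₂ (b≡p , j≡a₂))) = inj₂ (inj₁ (j≡a₂ , b≡p))

  triplePartners-functional : ∀ {b j j′} → TriplePartners b j → TriplePartners b j′ → j ≡ j′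
  triplePartners-functional (inj₁ t∈C)               (inj₁ t′∈C)               = triple-functional t∈C t′∈C
  triplePartners-functional (inj₁ t∈C)               (inj₂ (inj₁ (refl , _)))  = ⊥-elim (triple-a₂-¬codeword t∈C)
  triplePartners-functional (inj₁ t∈C)               (inj₂ (inj₂ (refl , _)))  = ⊥-elim (triple-p-¬codeword t∈C)
  triplePartners-functional (inj₂ (inj₁ (refl , _))) (inj₁ t′∈C)               = ⊥-elim (triple-a₂-¬codeword t′∈C)
  triplePartners-functional (inj₂ (inj₂ (refl , _))) (inj₁ t′∈C)               = ⊥-elim (triple-p-¬codeword t′∈C)
  triplePartners-functional (inj₂ (inj₁ (_ , j≡p)))  (inj₂ (inj₁ (_ , j′≡p)))  = trans j≡p (sym j′≡p)
  triplePartners-functional (inj₂ (inj₂ (_ , j≡a₂))) (inj₂ (inj₂ (_ , j′≡a₂))) = trans j≡a₂ (sym j′≡a₂)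
  triplePartners-functional (inj₂ (inj₁ (b≡a₂ , _))) (inj₂ (inj₂ (b≡p , _)))  = ⊥-elim (p≢a₂ (trans (sym b≡p) b≡a₂))
  triplePartners-functional (inj₂ (inj₂ (b≡p , _)))  (inj₂ (inj₁ (b≡a₂ , _))) = ⊥-elim (p≢a₂ (trans (sym b≡p) b≡a₂))

  triplePartnerOf : ∀ b → ∃ (TriplePartners b)
  triplePartnerOf b with b ≟ i | b ≟ a₂ | b ≟ p
  ... | yes refl | _         | _        = a₁ , inj₁ (subst C (sym (toggle-cancel zeros a₁ i)) single-i∈C)
  ... | no _     | yes b≡a₂  | _        = p , inj₂ (inj₁ (b≡a₂ , refl))
  ... | no _     | no _      | yes b≡p  = a₂ , inj₂ (inj₂ (b≡p , refl))
  ... | no b≢i   | no b≢a₂   | no b≢p with coveringCodeword (pair-a₁-isLucas b≢i b≢a₂)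
  ...   | c , c∈C , b~c with closedNbhd⇒toggle b~c
  ...     | inj₁ refl       = ⊥-elim (b≢p (toggledCodewords-unique (single-isLucas a₁) c∈C a₁p∈C))
  ...     | inj₂ (j , refl) = j , inj₁ c∈C

  triplePartners-loopless : ∀ x → ¬ TriplePartners x x
  triplePartners-loopless x (inj₁ t∈C) = a₁≢i (singleCodeword⇒≡ (subst C (toggle-involutive (single a₁) x) t∈C))
  triplePartners-loopless x (inj₂ (inj₁ (refl , a₂≡p))) = p≢a₂ (sym a₂≡p)
  triplePartners-loopless x (inj₂ (inj₂ (refl , p≡a₂))) = p≢a₂ p≡a₂

  length-even : ∃[ k ] suc (suc (suc m)) ≡ 2 * k
  length-even = Matching.loopless⇒even triplePartners-sym triplePartners-functional triplePartnerOf triplePartners-loopless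

  absurd : ⊥
  absurd = let k , even = length-even ; l , odd = length-odd in even≢odd k l (trans (sym even) odd)

zeros-codeword : ∀ {m} {C : Word (suc (suc (suc m))) → Set} → IsPerfectCodeLucas (suc (suc (suc m))) C → C zeros
zeros-codeword perfect with PerfectCode.coveringCodeword perfect zeros-isLucas
... | c , c∈C , zeros~c with closedNbhd⇒toggle zeros~c
...   | inj₁ refl       = c∈C
...   | inj₂ (i , refl) = ⊥-elim (SingletonCodeword.absurd perfect i c∈C)

mainTheorem2 : (n : ℕ) → n ≥ 6 → (C : Word n → Set) → IsPerfectCodeLucas n C →
    C (replicate n false)
mainTheorem2 _ (s≤s (s≤s (s≤s _))) C perfect = zeros-codeword perfect
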